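{- Let $n$ be a positive integer and $C_1=\mathrm{Circ}(\mathbb{F}_0,\mathbb{F}_1,\ldots,\mathbb{F}_{n-1})$. Then \[ \|C_1\|_E=\left[n^{2}\mathbb{F}_{n}^{2}-n\sum_{k=0}^{n-1}\frac{k+1}{F_{k+1}}\left(2\mathbb{F}_{k}+\frac{1}{F_{k+1}}\right)\right]^{1/2}. \]
   Context: $F_n$ denotes the Fibonacci numbers: $F_0=0$, $F_1=1$, $F_{n+2}=F_{n+1}+F_n$. The harmonic Fibonacci numbers are $\mathbb{F}_{n}=\sum_{k=1}^{n}\frac{1}{F_{k}}$ for $n\ge 1$, $\mathbb{F}_0=0$. For $c_0,\dots,c_{n-1}$, $\mathrm{Circ}(c_0,\ldots,c_{n-1})$ is the $n\times n$ circulant matrix whose first row is $(c_0,c_1,\ldots,c_{n-1})$ and each subsequent row is the cyclic right shift of the previous one (so the $(i,j)$ entry is $c_{(j-i)\bmod n}$). $\|A\|_E=\big(\sum_{i,j}|a_{ij}|^2\big)^{1/2}$ is the Euclidean (Frobenius) norm. -}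

module Defs where

open import Data.Nat as ℕ using (ℕ; zero; suc; NonZero; _≤_; z≤n; s≤s)
open import Data.Nat.Properties using (≤-trans; m≤m+n)
open import Data.Nat.DivMod using (_mod_)
open import Data.Fin as F using (Fin; toℕ)
open import Data.Integer using (+_)
open import Data.Rational using (ℚ; 0ℚ; _+_; _*_; _/_)

fib : ℕ → ℕ
fib 0 = 0
fib 1 = 1
fib (suc (suc n)) = fib (suc n) ℕ.+ fib n

fib-suc-pos : ∀ k → 1 ≤ fib (suc k)
fib-suc-pos zero = s≤s z≤n
fib-suc-pos (suc k) = ≤-trans (fib-suc-pos k) (m≤m+n (fib (suc k)) (fib k))

ℕtoℚ : ℕ → ℚ
ℕtoℚ n = (+ n) / 1

recipFib : ℕ → ℚ
recipFib k = (+ 1) / fib (suc k)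
  where instance _ = ℕ.>-nonZero (fib-suc-pos k)

-- harmonic Fibonacci numbers: HF 0 = 0, HF n = Σ_{k=1}^{n} 1/F_k
HF : ℕ → ℚ
HF zero = 0ℚ
HF (suc n) = HF n + recipFib n

sumFin : (n : ℕ) → (Fin n → ℚ) → ℚ
sumFin zero f = 0ℚ
sumFin (suc n) f = f F.zero + sumFin n (λ i → f (F.suc i))

sumRange : ℕ → (ℕ → ℚ) → ℚ
sumRange zero f = 0ℚ
sumRange (suc n) f = sumRange n f + f n

circ : (n : ℕ) .{{_ : NonZero n}} → (Fin n → ℚ) → Fin n → Fin n → ℚ
circ n c i j = c ((toℕ j ℕ.+ (n ℕ.∸ toℕ i)) mod n)

frobeniusNormSq : (n : ℕ) → (Fin n → Fin n → ℚ) → ℚ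
frobeniusNormSq n A = sumFin n (λ i → sumFin n (λ j → A i j * A i j))

C₁ : (n : ℕ) .{{_ : NonZero n}} → Fin n → Fin n → ℚ
C₁ n = circ n (λ k → HF (toℕ k))

{-# OPTIONS --safe #-}
module Submission where

-- Every row of a circulant matrix is a cyclic rotation of its first row, so
-- ‖Circ(c)‖_E² = n Σ_k c_k².  For c_k = 𝔽_k the sum of squares is evaluated by
-- summation by parts: Σ_{k<n} 𝔽_k² = n 𝔽_n² − Σ_{k<n} (k+1)(𝔽_{k+1}² − 𝔽_k²), and
-- 𝔽_{k+1}² − 𝔽_k² = (1/F_{k+1})(2𝔽_k + 1/F_{k+1}) because 𝔽_{k+1} = 𝔽_k + 1/F_{k+1}.

open import Defs
open import Algebra.Bundles using (AbelianGroup)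
open import Data.Nat as ℕ using (ℕ; NonZero; zero; suc; _<_)
import Data.Nat.Properties as ℕ
import Data.Nat.Coprimality as Coprimality
open import Data.Nat.DivMod using (_mod_; [m+n]%n≡m%n; m<n⇒m%n≡m)
open import Data.Fin as Fin using (Fin; toℕ)
open import Data.Fin.Properties using (toℕ<n; fromℕ<-cong; fromℕ<-toℕ)
import Data.Integer.Properties as ℤ
open import Data.Rational using (ℚ; 1ℚ; _+_; _-_; _*_)
open import Data.Rational.Properties
  using (normalize-coprime; +-assoc; +-comm; +-identityˡ; +-identityʳ; *-zeroˡ; +-0-abelianGroup)
open import Data.Rational.Solver using (module +-*-Solver)
open import Algebra.Properties.Group (AbelianGroup.group +-0-abelianGroup)
  using () renaming (∙-cancelˡ to +-cancelˡ)
open import Relation.Binary.PropositionalEquality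
open ≡-Reasoning
open +-*-Solver

-- Once (+ a) / 1 and (+ b) / 1 are exposed as normalised mkℚ values, the sum computes.
ℕtoℚ-+ : ∀ a b → ℕtoℚ (a ℕ.+ b) ≡ ℕtoℚ a + ℕtoℚ b
ℕtoℚ-+ a b
  rewrite normalize-coprime (Coprimality.sym (Coprimality.1-coprimeTo a))
        | normalize-coprime (Coprimality.sym (Coprimality.1-coprimeTo b))
        | ℕ.*-identityʳ a | ℕ.*-identityʳ b | ℤ.+◃n≡+n a | ℤ.+◃n≡+n b
  = refl

ℕtoℚ-suc : ∀ n → ℕtoℚ (suc n) ≡ 1ℚ + ℕtoℚ n
ℕtoℚ-suc = ℕtoℚ-+ 1

sumFin-cong : ∀ n {f g : Fin n → ℚ} → (∀ i → f i ≡ g i) → sumFin n f ≡ sumFin n g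
sumFin-cong zero    f≗g = refl
sumFin-cong (suc n) f≗g = cong₂ _+_ (f≗g Fin.zero) (sumFin-cong n (λ i → f≗g (Fin.suc i)))

sumFin-const : ∀ n x → sumFin n (λ _ → x) ≡ ℕtoℚ n * x
sumFin-const zero    x = sym (*-zeroˡ x)
sumFin-const (suc n) x = begin
  x + sumFin n (λ _ → x)  ≡⟨ cong (x +_) (sumFin-const n x) ⟩
  x + ℕtoℚ n * x          ≡⟨ solve 2 (λ x m → x :+ m :* x := (con 1ℚ :+ m) :* x) refl x (ℕtoℚ n) ⟩
  (1ℚ + ℕtoℚ n) * x       ≡⟨ cong (_* x) (ℕtoℚ-suc n) ⟨
  ℕtoℚ (suc n) * x        ∎

sumRange-cong : ∀ n {f g : ℕ → ℚ} → (∀ k → k < n → f k ≡ g k) → sumRange n f ≡ sumRange n g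
sumRange-cong zero    f≗g = refl
sumRange-cong (suc n) f≗g =
  cong₂ _+_ (sumRange-cong n (λ k k<n → f≗g k (ℕ.m<n⇒m<1+n k<n))) (f≗g n ℕ.≤-refl)

sumRange-suc-head : ∀ n f → sumRange (suc n) f ≡ f 0 + sumRange n (λ k → f (suc k))
sumRange-suc-head zero    f = trans (+-identityˡ (f 0)) (sym (+-identityʳ (f 0)))
sumRange-suc-head (suc n) f = begin
  sumRange (suc n) f + f (suc n)                      ≡⟨ cong (_+ f (suc n)) (sumRange-suc-head n f) ⟩
  (f 0 + sumRange n (λ k → f (suc k))) + f (suc n)    ≡⟨ +-assoc (f 0) _ (f (suc n)) ⟩
  f 0 + sumRange (suc n) (λ k → f (suc k))            ∎

sumFin-toℕ : ∀ n (f : ℕ → ℚ) → sumFin n (λ i → f (toℕ i)) ≡ sumRange n f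
sumFin-toℕ zero    f = refl
sumFin-toℕ (suc n) f = begin
  f 0 + sumFin n (λ i → f (suc (toℕ i)))  ≡⟨ cong (f 0 +_) (sumFin-toℕ n (λ k → f (suc k))) ⟩
  f 0 + sumRange n (λ k → f (suc k))      ≡⟨ sumRange-suc-head n f ⟨
  sumRange (suc n) f                      ∎

-- One shift moves the first term f s to the end, where it reappears as f (s + n).
sumRange-shift-periodic : ∀ n (f : ℕ → ℚ) → (∀ k → f (k ℕ.+ n) ≡ f k) →
                          ∀ s → sumRange n (λ k → f (k ℕ.+ s)) ≡ sumRange n f
sumRange-shift-periodic n f periodic zero =
  sumRange-cong n (λ k _ → cong f (ℕ.+-identityʳ k))
sumRange-shift-periodic n f periodic (suc s) = begin
  sumRange n (λ k → f (k ℕ.+ suc s))  ≡⟨ sumRange-cong n (λ k _ → cong f (ℕ.+-suc k s)) ⟩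
  sumRange n (λ k → f (suc k ℕ.+ s))  ≡⟨ +-cancelˡ (f s) _ _ rotated ⟩
  sumRange n (λ k → f (k ℕ.+ s))      ≡⟨ sumRange-shift-periodic n f periodic s ⟩
  sumRange n f                        ∎
  where
  rotated : f s + sumRange n (λ k → f (suc k ℕ.+ s)) ≡ f s + sumRange n (λ k → f (k ℕ.+ s))
  rotated = begin
    f s + sumRange n (λ k → f (suc k ℕ.+ s))  ≡⟨ sumRange-suc-head n (λ k → f (k ℕ.+ s)) ⟨
    sumRange n (λ k → f (k ℕ.+ s)) + f (n ℕ.+ s)
      ≡⟨ cong (λ t → sumRange n (λ k → f (k ℕ.+ s)) + t) (trans (cong f (ℕ.+-comm n s)) (periodic s)) ⟩
    sumRange n (λ k → f (k ℕ.+ s)) + f s      ≡⟨ +-comm _ (f s) ⟩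
    f s + sumRange n (λ k → f (k ℕ.+ s))      ∎

toℕ-mod : ∀ {n} .{{_ : NonZero n}} (i : Fin n) → toℕ i mod n ≡ i
toℕ-mod i = trans (fromℕ<-cong _ _ (m<n⇒m%n≡m (toℕ<n i)) _ (toℕ<n i)) (fromℕ<-toℕ i (toℕ<n i))

sumFin-rotate : ∀ n .{{_ : NonZero n}} (f : Fin n → ℚ) s →
                sumFin n (λ j → f ((toℕ j ℕ.+ s) mod n)) ≡ sumFin n f
sumFin-rotate n f s = begin
  sumFin n (λ j → f ((toℕ j ℕ.+ s) mod n))  ≡⟨ sumFin-toℕ n (λ k → f′ (k ℕ.+ s)) ⟩
  sumRange n (λ k → f′ (k ℕ.+ s))           ≡⟨ sumRange-shift-periodic n f′ periodic s ⟩
  sumRange n f′                             ≡⟨ sumFin-toℕ n f′ ⟨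
  sumFin n (λ j → f (toℕ j mod n))          ≡⟨ sumFin-cong n (λ j → cong f (toℕ-mod j)) ⟩
  sumFin n f                                ∎
  where
  f′ : ℕ → ℚ
  f′ k = f (k mod n)
  periodic : ∀ k → f′ (k ℕ.+ n) ≡ f′ k
  periodic k = cong f (fromℕ<-cong _ _ ([m+n]%n≡m%n k n) _ _)

frobeniusNormSq-circ : ∀ n .{{_ : NonZero n}} (c : Fin n → ℚ) →
                       frobeniusNormSq n (circ n c) ≡ ℕtoℚ n * sumFin n (λ k → c k * c k)
frobeniusNormSq-circ n c = begin
  frobeniusNormSq n (circ n c)            ≡⟨ sumFin-cong n (λ i → sumFin-rotate n (λ k → c k * c k) _) ⟩
  sumFin n (λ _ → sumFin n (λ k → c k * c k))  ≡⟨ sumFin-const n _ ⟩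
  ℕtoℚ n * sumFin n (λ k → c k * c k)     ∎

-- (k+1)(𝔽_{k+1}² − 𝔽_k²), written without subtraction via 𝔽_{k+1} = 𝔽_k + 1/F_{k+1}.
weightedSquareGap : ℕ → ℚ
weightedSquareGap k = (ℕtoℚ (suc k) * recipFib k) * ((ℕtoℚ 2 * HF k) + recipFib k)

sumRange-HF² : ∀ n → sumRange n (λ k → HF k * HF k)
                     ≡ ℕtoℚ n * (HF n * HF n) - sumRange n weightedSquareGap
sumRange-HF² zero    = refl
sumRange-HF² (suc n) = begin
  sumRange n (λ k → HF k * HF k) + H * H
    ≡⟨ cong (_+ H * H) (sumRange-HF² n) ⟩
  (ℕtoℚ n * (H * H) - G) + H * H
    ≡⟨ solve 4 (λ m h r g → (m :* (h :* h) :- g) :+ h :* h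
                 := (con 1ℚ :+ m) :* ((h :+ r) :* (h :+ r))
                    :- (g :+ ((con 1ℚ :+ m) :* r) :* ((con 1ℚ :+ con 1ℚ) :* h :+ r)))
         refl (ℕtoℚ n) H r G ⟩
  (1ℚ + ℕtoℚ n) * ((H + r) * (H + r)) - (G + ((1ℚ + ℕtoℚ n) * r) * ((ℕtoℚ 1 + ℕtoℚ 1) * H + r))
    ≡⟨ cong₂ (λ m two → m * ((H + r) * (H + r)) - (G + (m * r) * (two * H + r)))
             (ℕtoℚ-suc n) (ℕtoℚ-+ 1 1) ⟨
  ℕtoℚ (suc n) * (HF (suc n) * HF (suc n)) - sumRange (suc n) weightedSquareGap
    ∎
  where
  H = HF n
  r = recipFib n
  G = sumRange n weightedSquareGap

mainTheorem13 : (n : ℕ) .{{_ : NonZero n}} →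
    frobeniusNormSq n (C₁ n)
      ≡ (ℕtoℚ n * ℕtoℚ n) * (HF n * HF n)
        - ℕtoℚ n * sumRange n (λ k → (ℕtoℚ (suc k) * recipFib k) * ((ℕtoℚ 2 * HF k) + recipFib k))
mainTheorem13 n = begin
  frobeniusNormSq n (C₁ n)
    ≡⟨ frobeniusNormSq-circ n (λ k → HF (toℕ k)) ⟩
  ℕtoℚ n * sumFin n (λ k → HF (toℕ k) * HF (toℕ k))
    ≡⟨ cong (ℕtoℚ n *_) (sumFin-toℕ n (λ k → HF k * HF k)) ⟩
  ℕtoℚ n * sumRange n (λ k → HF k * HF k)
    ≡⟨ cong (ℕtoℚ n *_) (sumRange-HF² n) ⟩
  ℕtoℚ n * (ℕtoℚ n * (HF n * HF n) - sumRange n weightedSquareGap)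
    ≡⟨ solve 3 (λ m h g → m :* (m :* (h :* h) :- g) := (m :* m) :* (h :* h) :- m :* g)
         refl (ℕtoℚ n) (HF n) (sumRange n weightedSquareGap) ⟩
  (ℕtoℚ n * ℕtoℚ n) * (HF n * HF n) - ℕtoℚ n * sumRange n weightedSquareGap
    ∎
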